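{- Let $N\ge0$ and let $\mathcal V\subseteq\Omega_N\cup\{V\}$ be a finite set of steps with $V\in\mathcal V$ and $U_N\in\mathcal V$. Let $K$ be the largest integer with $D_K\in\mathcal V$, and suppose $K\ge2$. Then for $n\ge1$, $|\mathcal P_{\mathcal V}(K,n)|=|\mathcal P_{\mathcal V}(0,n-1)|$.
   Context: Steps: $V=(0,-1)$ and $S_k=(1,k)$ for $k\in\mathbb Z$; $U_k=S_k$ for $k\ge0$, $D_j=S_{ -j}$ for $j\ge1$. $\Omega_N=\{S_k:k\le N\}$. For a set of steps $\mathcal S$, an $\mathcal S$-path is a finite (possibly empty) sequence of steps from $\mathcal S$ starting at $(0,0)$. $\mathcal P_{\mathcal S}(m,n)$ is the set of $\mathcal S$-paths ending at $(n,-m)$ all of whose points except possibly the last lie on or above the $x$-axis. -}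

module Defs where

open import Data.Bool using (Bool; true; false; _∧_; T)
open import Data.Nat using (ℕ)
open import Data.Integer using (ℤ; +_; -_; _+_; _≤ᵇ_; _≟_)
open import Data.Product using (_×_; _,_; Σ; proj₁; proj₂)
open import Data.List using (List; []; _∷_)
open import Relation.Nullary using (yes; no)
open import Relation.Nullary.Decidable using (⌊_⌋)
open import Relation.Binary.PropositionalEquality using (_≡_)

-- Steps: V = (0,-1) and S k = (1,k), k ∈ ℤ.
data Step : Set where
  V : Step
  S : ℤ → Step

U : ℕ → Step
U k = S (+ k)

D : ℕ → Step
D j = S (- (+ j))

_==_ : Step → Step → Bool
V == V = true
V == S _ = false
S _ == V = false
S k == S l = ⌊ k ≟ l ⌋

elem : Step → List Step → Bool
elem s [] = false
elem s (t ∷ ts) = (s == t) Data.Bool.∨ elem s ts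

Point : Set
Point = ℤ × ℤ

move : Point → Step → Point
move (x , y) V = (x , y + (- (+ 1)))
move (x , y) (S k) = (x + (+ 1) , y + k)

endFrom : Point → List Step → Point
endFrom p [] = p
endFrom p (s ∷ ss) = endFrom (move p s) ss

aboveExceptLast : Point → List Step → Bool
aboveExceptLast p [] = true
aboveExceptLast (x , y) (s ∷ ss) = ((+ 0) ≤ᵇ y) ∧ aboveExceptLast (move (x , y) s) ss

allIn : List Step → List Step → Bool
allIn [] 𝒮 = true
allIn (s ∷ ss) 𝒮 = elem s 𝒮 ∧ allIn ss 𝒮

-- 𝒫_𝒮(m,n): 𝒮-paths from (0,0) ending at (n,-m), all points but the last
-- on or above the x-axis.  (Proof component is T of a Bool, hence
-- proof-irrelevant, so this type is in bijection with the set of paths.)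
IsPath : List Step → ℕ → ℕ → List Step → Set
IsPath 𝒮 m n p =
  T (allIn p 𝒮 ∧ aboveExceptLast (+ 0 , + 0) p) × (endFrom (+ 0 , + 0) p ≡ (+ n , - (+ m)))

𝒫 : List Step → ℕ → ℕ → Set
𝒫 𝒮 m n = Σ (List Step) (IsPath 𝒮 m n)

-- The last step of a path in 𝒫_𝒱(K, n+1) starts on or above the x-axis
-- and ends at height -K, while no step of 𝒱 descends by more than K.  So
-- it starts at height 0 and is D_K itself (V descends by only 1 < K), and
-- removing it leaves a path in 𝒫_𝒱(0, n).  Appending D_K inverts this.
module Submission where

open import Defs
open import Data.Nat using (ℕ; suc; _≥_)
open import Data.Integer using (ℤ; +_; _≤_)
open import Data.List using (List)
open import Data.List.Membership.Propositional using (_∈_)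
open import Function.Bundles using (_↔_; mk↔ₛ′; Equivalence)

open import Data.Nat using (zero; s≤s; z≤n)
import Data.Nat.Properties as ℕP
open import Data.Integer as ℤ using (-[1+_]; -_; _+_; _≤ᵇ_; +≤+; +<+)
import Data.Integer.Properties as ℤP
open import Algebra.Properties.AbelianGroup ℤP.+-0-abelianGroup using (∙-cancelʳ)
open import Data.List using ([]; _∷_; _∷ʳ_; initLast; _∷ʳ′_)
open import Data.List.Properties using (∷ʳ-injectiveˡ)
open import Data.List.Relation.Unary.Any using (here; there)
open import Data.Bool using (Bool; true; false; T; _∧_)
open import Data.Bool.Properties using (T-∧; T-irrelevant; ∧-comm; ∧-identityʳ; ∧-assoc)
open import Data.Unit using (tt)
open import Data.Empty using (⊥-elim)
open import Data.Product using (Σ; _×_; _,_; proj₁; proj₂; map₁)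
import Data.Product.Properties as ×P
open import Relation.Nullary.Decidable using (toWitness; fromWitness)
open import Relation.Binary.PropositionalEquality
open import Axiom.UniquenessOfIdentityProofs using (module Decidable⇒UIP)

origin : Point
origin = + 0 , + 0

∧-intro : ∀ {a b} → T a → T b → T (a ∧ b)
∧-intro ta tb = Equivalence.from T-∧ (ta , tb)

∧-elim : ∀ {a b} → T (a ∧ b) → T a × T b
∧-elim = Equivalence.to T-∧

==-sound : ∀ s t → T (s == t) → s ≡ t
==-sound V V _ = refl
==-sound (S k) (S l) k≟l = cong S (toWitness {a? = k ℤ.≟ l} k≟l)

==-refl : ∀ s → T (s == s)
==-refl V = tt
==-refl (S k) = fromWitness {a? = k ℤ.≟ k} refl

elem-sound : ∀ s ts → T (elem s ts) → s ∈ ts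
elem-sound s (t ∷ ts) s∈ with s == t | ==-sound s t
... | true  | s≡t = here (s≡t tt)
... | false | _   = there (elem-sound s ts s∈)

elem-complete : ∀ {s ts} → s ∈ ts → T (elem s ts)
elem-complete {s} (here refl) with s == s | ==-refl s
... | true | _ = tt
elem-complete {s} {t ∷ _} (there s∈) with s == t
... | true  = tt
... | false = elem-complete s∈

IsPath-irrelevant : ∀ 𝒮 m n p (a b : IsPath 𝒮 m n p) → a ≡ b
IsPath-irrelevant 𝒮 m n p (t , e) (t′ , e′) =
  cong₂ _,_ (T-irrelevant t t′) (Decidable⇒UIP.≡-irrelevant (×P.≡-dec ℤ._≟_ ℤ._≟_) e e′)

𝒫-≡ : ∀ {𝒮 m n} {p q : 𝒫 𝒮 m n} → proj₁ p ≡ proj₁ q → p ≡ q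
𝒫-≡ {𝒮} {m} {n} {xs , _} refl = cong (xs ,_) (IsPath-irrelevant 𝒮 m n xs _ _)

endFrom-∷ʳ : ∀ p xs s → endFrom p (xs ∷ʳ s) ≡ move (endFrom p xs) s
endFrom-∷ʳ p []       s = refl
endFrom-∷ʳ p (t ∷ ts) s = endFrom-∷ʳ (move p t) ts s

aboveExceptLast-∷ʳ : ∀ p xs s →
  aboveExceptLast p (xs ∷ʳ s) ≡ aboveExceptLast p xs ∧ (+ 0 ≤ᵇ proj₂ (endFrom p xs))
aboveExceptLast-∷ʳ p       []       s = ∧-identityʳ _
aboveExceptLast-∷ʳ (x , y) (t ∷ ts) s = begin
  (+ 0 ≤ᵇ y) ∧ aboveExceptLast (move (x , y) t) (ts ∷ʳ s)
    ≡⟨ cong ((+ 0 ≤ᵇ y) ∧_) (aboveExceptLast-∷ʳ (move (x , y) t) ts s) ⟩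
  (+ 0 ≤ᵇ y) ∧ (aboveExceptLast (move (x , y) t) ts ∧ _)
    ≡⟨ ∧-assoc (+ 0 ≤ᵇ y) _ _ ⟨
  ((+ 0 ≤ᵇ y) ∧ aboveExceptLast (move (x , y) t) ts) ∧ _ ∎
  where open ≡-Reasoning

allIn-∷ʳ : ∀ xs s 𝒮 → allIn (xs ∷ʳ s) 𝒮 ≡ allIn xs 𝒮 ∧ elem s 𝒮
allIn-∷ʳ []       s 𝒮 = ∧-identityʳ _
allIn-∷ʳ (t ∷ ts) s 𝒮 =
  trans (cong (elem t 𝒮 ∧_) (allIn-∷ʳ ts s 𝒮)) (sym (∧-assoc (elem t 𝒮) _ _))

Valid : List Step → List Step → Bool
Valid 𝒮 p = allIn p 𝒮 ∧ aboveExceptLast origin p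

∧-interchange : ∀ a e b h → (a ∧ e) ∧ (b ∧ h) ≡ ((a ∧ b) ∧ h) ∧ e
∧-interchange true  e b h = ∧-comm e (b ∧ h)
∧-interchange false e b h = refl

Valid-∷ʳ : ∀ 𝒮 xs s →
  Valid 𝒮 (xs ∷ʳ s) ≡ (Valid 𝒮 xs ∧ (+ 0 ≤ᵇ proj₂ (endFrom origin xs))) ∧ elem s 𝒮
Valid-∷ʳ 𝒮 xs s =
  trans (cong₂ _∧_ (allIn-∷ʳ xs s 𝒮) (aboveExceptLast-∷ʳ origin xs s))
        (∧-interchange (allIn xs 𝒮) _ _ _)

rise : Step → ℤ
rise V     = - + 1
rise (S k) = k

height-move : ∀ p s → proj₂ (move p s) ≡ proj₂ p + rise s
height-move (_ , _) V     = refl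
height-move (_ , _) (S k) = refl

DropsAtMost : List Step → ℕ → Set
DropsAtMost 𝒱 K = ∀ (j : ℕ) → j ≥ 1 → D j ∈ 𝒱 → K ≥ j

rise-≥ : ∀ {𝒱 K s} → K ≥ 1 → DropsAtMost 𝒱 K → s ∈ 𝒱 → - + K ≤ rise s
rise-≥ {s = V}           K≥1 _     _  = ℤP.neg-mono-≤ (+≤+ K≥1)
rise-≥ {s = S (+ _)}     _   _     _  = ℤP.neg-≤-pos
rise-≥ {s = S -[1+ j ]}  _   drops s∈ = ℤP.neg-mono-≤ (+≤+ (drops (suc j) (s≤s z≤n) s∈))

rise≡-K⇒D : ∀ {K} s → K ≥ 2 → rise s ≡ - + K → s ≡ D K
rise≡-K⇒D V     (s≤s (s≤s _)) ()
rise≡-K⇒D (S k) _             k≡-K = cong S k≡-K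

0≤i⇒j≤k⇒i+k≡j⇒k≡j : ∀ {i j k} → + 0 ≤ i → j ≤ k → i + k ≡ j → k ≡ j
0≤i⇒j≤k⇒i+k≡j⇒k≡j {+ zero}  {j} {k} _ _ i+k≡j = trans (sym (ℤP.+-identityˡ k)) i+k≡j
0≤i⇒j≤k⇒i+k≡j⇒k≡j {+ suc i} {j} {k} _ j≤k i+k≡j =
  ⊥-elim (ℤP.<-irrefl refl (ℤP.≤-<-trans j≤k k<j))
  where
  k<j : k ℤ.< j
  k<j = subst₂ ℤ._<_ (ℤP.+-identityˡ k) i+k≡j (ℤP.+-monoˡ-< k (+<+ (s≤s z≤n)))

move-injective : ∀ s {p q} → move p s ≡ move q s → p ≡ q
move-injective V     {x , y} {x′ , y′} e =
  cong₂ _,_ (cong proj₁ e) (∙-cancelʳ (- + 1) y y′ (cong proj₂ e))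
move-injective (S k) {x , y} {x′ , y′} e =
  cong₂ _,_ (∙-cancelʳ (+ 1) x x′ (cong proj₁ e)) (∙-cancelʳ k y y′ (cong proj₂ e))

move-D : ∀ n K → move (+ n , + 0) (D K) ≡ (+ suc n , - + K)
move-D n K = cong₂ _,_ (cong +_ (ℕP.+-comm n 1)) (ℤP.+-identityˡ (- + K))

finalStep : ∀ {𝒱 K n s} p → K ≥ 2 → DropsAtMost 𝒱 K → s ∈ 𝒱 →
  + 0 ≤ proj₂ p → move p s ≡ (+ suc n , - + K) → s ≡ D K × p ≡ (+ n , + 0)
finalStep {K = K} {n} {s} p@(_ , y) K≥2 drops s∈ 0≤y e = s≡D , p≡
  where
  s≡D : s ≡ D K
  s≡D = rise≡-K⇒D s K≥2
          (0≤i⇒j≤k⇒i+k≡j⇒k≡j 0≤y (rise-≥ (ℕP.≤-trans (s≤s z≤n) K≥2) drops s∈)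
            (trans (sym (height-move p s)) (cong proj₂ e)))
  p≡ : p ≡ (+ n , + 0)
  p≡ = move-injective (D K) (begin
    move p (D K)         ≡⟨ cong (move p) s≡D ⟨
    move p s             ≡⟨ e ⟩
    (+ suc n , - + K)    ≡⟨ move-D n K ⟨
    move (+ n , + 0) (D K) ∎)
    where open ≡-Reasoning

removeFinalDescent : ∀ {𝒱 K} n p → K ≥ 2 → DropsAtMost 𝒱 K → IsPath 𝒱 K (suc n) p →
  Σ (List Step) λ xs → p ≡ xs ∷ʳ D K × IsPath 𝒱 0 n xs
removeFinalDescent n p K≥2 drops (valid , ends) with initLast p
removeFinalDescent n .[] K≥2 drops (_ , ()) | []
removeFinalDescent {𝒱} {K} n .(xs ∷ʳ s) K≥2 drops (valid , ends) | xs ∷ʳ′ s =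
  xs , cong (xs ∷ʳ_) (proj₁ last) , proj₁ (proj₁ pieces) , proj₂ last
  where
  pieces : (T (Valid 𝒱 xs) × T (+ 0 ≤ᵇ proj₂ (endFrom origin xs))) × T (elem s 𝒱)
  pieces = map₁ ∧-elim (∧-elim (subst T (Valid-∷ʳ 𝒱 xs s) valid))
  last : s ≡ D K × endFrom origin xs ≡ (+ n , + 0)
  last = finalStep (endFrom origin xs) K≥2 drops
           (elem-sound s 𝒱 (proj₂ pieces))
           (ℤP.≤ᵇ⇒≤ (proj₂ (proj₁ pieces)))
           (trans (sym (endFrom-∷ʳ origin xs s)) ends)

appendFinalDescent : ∀ {𝒱 K} n xs → D K ∈ 𝒱 → IsPath 𝒱 0 n xs →
  IsPath 𝒱 K (suc n) (xs ∷ʳ D K)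
appendFinalDescent {𝒱} {K} n xs DK∈ (valid , ends) =
  subst T (sym (Valid-∷ʳ 𝒱 xs (D K)))
    (∧-intro (∧-intro valid (subst (λ q → T (+ 0 ≤ᵇ proj₂ q)) (sym ends) tt))
             (elem-complete DK∈))
  , trans (endFrom-∷ʳ origin xs (D K)) (trans (cong (λ q → move q (D K)) ends) (move-D n K))

𝒫-↔-removeFinalDescent : ∀ {𝒱 K} n → K ≥ 2 → D K ∈ 𝒱 → DropsAtMost 𝒱 K →
  𝒫 𝒱 K (suc n) ↔ 𝒫 𝒱 0 n
𝒫-↔-removeFinalDescent {𝒱} {K} n K≥2 DK∈ drops = mk↔ₛ′ to from to∘from from∘to
  where
  remove : (p : 𝒫 𝒱 K (suc n)) → Σ (List Step) λ xs → proj₁ p ≡ xs ∷ʳ D K × IsPath 𝒱 0 n xs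
  remove (p , ip) = removeFinalDescent n p K≥2 drops ip
  to : 𝒫 𝒱 K (suc n) → 𝒫 𝒱 0 n
  to p = proj₁ (remove p) , proj₂ (proj₂ (remove p))
  from : 𝒫 𝒱 0 n → 𝒫 𝒱 K (suc n)
  from (xs , ixs) = xs ∷ʳ D K , appendFinalDescent n xs DK∈ ixs
  to∘from : ∀ q → to (from q) ≡ q
  to∘from q@(xs , _) = 𝒫-≡ {m = 0} (sym (∷ʳ-injectiveˡ xs _ (proj₁ (proj₂ (remove (from q))))))
  from∘to : ∀ p → from (to p) ≡ p
  from∘to p = 𝒫-≡ {m = K} (sym (proj₁ (proj₂ (remove p))))

mainTheorem12 : (N : ℕ) (𝒱 : List Step) (K : ℕ) →
    (∀ (k : ℤ) → S k ∈ 𝒱 → k ≤ + N) →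
    V ∈ 𝒱 → U N ∈ 𝒱 →
    K ≥ 1 → D K ∈ 𝒱 → (∀ (j : ℕ) → j ≥ 1 → D j ∈ 𝒱 → K ≥ j) →
    K ≥ 2 →
    (n : ℕ) → 𝒫 𝒱 K (suc n) ↔ 𝒫 𝒱 0 n
mainTheorem12 _ _ _ _ _ _ _ DK∈ drops K≥2 n = 𝒫-↔-removeFinalDescent n K≥2 DK∈ drops
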